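{- Let $C$ be an $X$-neighbour transitive code in $H(m,q)$ with minimum distance $\delta\geq 3$, let $\mathcal{J}=\{J_1,\ldots,J_\ell\}$ be an $X$-invariant partition of $M=\{1,\ldots,m\}$, and let $J,J'\in\mathcal{J}$. Then the action of $\chi(X_J)$ on $\pi_J(C)$ is permutationally isomorphic to the action of $\chi(X_{J'})$ on $\pi_{J'}(C)$. Moreover, $\pi_J(C)$ and $\pi_{J'}(C)$ have the same minimum distance.
   Context: $H(m,q)$ is the Hamming graph on $Q^m$, $|Q|=q$; $\mathrm{Aut}(H(m,q))=B\rtimes L$, $B=S_q^m$, $L\cong S_m$, acting by $\alpha^{(h_1,\ldots,h_m)}=(\alpha_1^{h_1},\ldots,\alpha_m^{h_m})$, $\alpha^\sigma=(\alpha_{1\sigma^{ -1}},\ldots,\alpha_{m\sigma^{ -1}})$; elements written $h\sigma$. For a code $D$, $D_1$ is the set of vertices at distance exactly $1$ from $D$; $D$ is $X$-neighbour transitive if $D$ and $D_1$ are $X$-orbits. A partition $\mathcal{J}$ of $M$ is $X$-invariant if $J^\sigma\in\mathcal{J}$ for all $J\in\mathcal{J}$, $h\sigma\in X$. For $J=\{i_1<\cdots<i_k\}$, $\pi_J(\alpha)=(\alpha_{i_1},\ldots,\alpha_{i_k})\in H(J,q)$, $\pi_J(C)=\{\pi_J(\alpha):\alpha\in C\}$. $X_J=\{h\sigma\in X:J^\sigma=J\}$ and for $x\in X_J$, $\chi(x)$ is the automorphism $\pi_J(\alpha)\mapsto\pi_J(\alpha^x)$ of $H(J,q)$. Two actions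 $\rho_1:G\to\mathrm{Sym}(\Omega)$, $\rho_2:H\to\mathrm{Sym}(\Omega')$ are permutationally isomorphic if there are a bijection $\lambda:\Omega\to\Omega'$ and an isomorphism $\varphi:\rho_1(G)\to\rho_2(H)$ with $\lambda(\omega^{g})=\lambda(\omega)^{\varphi(g)}$ for all $\omega\in\Omega$, $g\in\rho_1(G)$. -}

module Defs where

open import Data.Nat using (ℕ; zero; suc; _≤_)
open import Data.Bool using (Bool; true; false)
open import Data.Fin using (Fin; _≟_)
open import Data.Fin.Subset using (Subset; _∈_; Nonempty)
open import Data.Fin.Permutation using (Permutation′; _⟨$⟩ʳ_; _⟨$⟩ˡ_; _∘ₚ_; flip; id)
open import Data.Vec using (Vec; []; _∷_; lookup; tabulate)
open import Data.Product using (Σ; ∃; _×_; _,_)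
open import Relation.Nullary using (¬_; yes; no)
open import Relation.Binary.PropositionalEquality using (_≡_; _≢_)

-- The Hamming graph H(m,q): vertices Q^m with Q = Fin q, M = Fin m.

Word : ℕ → ℕ → Set
Word m q = Vec (Fin q) m

-- Hamming distance (number of coordinates in which two words differ);
-- adjacency in H(m,q) is distance 1.
dist : ∀ {n q} → Vec (Fin q) n → Vec (Fin q) n → ℕ
dist [] [] = 0
dist (a ∷ u) (b ∷ v) with a ≟ b
... | yes _ = dist u v
... | no  _ = suc (dist u v)

Code : ℕ → ℕ → Set₁
Code m q = Word m q → Set

-- Minimum distance: C has minimum distance δ (requires |C| ≥ 2).
HasMinDist : ∀ {n q} → (Vec (Fin q) n → Set) → ℕ → Set
HasMinDist {n} {q} C δ =
  (Σ (Vec (Fin q) n) λ α → Σ (Vec (Fin q) n) λ β →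
     C α × C β × α ≢ β × dist α β ≡ δ)
  × (∀ α β → C α → C β → α ≢ β → δ ≤ dist α β)

-- Aut(H(m,q)) = B ⋊ L, elements h σ with h ∈ S_q^m, σ ∈ S_m.

record Aut (m q : ℕ) : Set where
  constructor _·_
  field
    h : Fin m → Permutation′ q
    σ : Permutation′ m
open Aut public

-- α^(h σ): first α^h = (α_i^{h_i}), then (β^σ)_i = β_{iσ⁻¹}.
act : ∀ {m q} → Word m q → Aut m q → Word m q
act α x = tabulate λ i → h x (σ x ⟨$⟩ˡ i) ⟨$⟩ʳ lookup α (σ x ⟨$⟩ˡ i)

-- product in Aut: α^(x y) = (α^x)^y
_⊙_ : ∀ {m q} → Aut m q → Aut m q → Aut m q
x ⊙ y = (λ j → h x j ∘ₚ h y (σ x ⟨$⟩ʳ j)) · (σ x ∘ₚ σ y)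

idAut : ∀ {m q} → Aut m q
idAut = (λ _ → id) · id

invAut : ∀ {m q} → Aut m q → Aut m q
invAut x = (λ i → flip (h x (σ x ⟨$⟩ˡ i))) · flip (σ x)

IsSubgroup : ∀ {m q} → (Aut m q → Set) → Set
IsSubgroup X = X idAut × (∀ x y → X x → X y → X (x ⊙ y)) × (∀ x → X x → X (invAut x))

IsOrbit : ∀ {m q} → (Aut m q → Set) → Code m q → Set
IsOrbit {m} {q} X D =
  (Σ (Word m q) D)
  × (∀ α x → D α → X x → D (act α x))
  × (∀ α β → D α → D β → Σ (Aut m q) λ x → X x × act α x ≡ β)

Nbhd : ∀ {m q} → Code m q → Code m q
Nbhd {m} {q} D α = ¬ D α × (Σ (Word m q) λ β → D β × dist α β ≡ 1)

NeighbourTransitive : ∀ {m q} → (Aut m q → Set) → Code m q → Set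
NeighbourTransitive X C = IsOrbit X C × IsOrbit X (Nbhd C)

-- J^σ = { iσ : i ∈ J }, i.e. i ∈ J^σ iff iσ⁻¹ ∈ J.
image : ∀ {m} → Permutation′ m → Subset m → Subset m
image s J = tabulate λ i → lookup J (s ⟨$⟩ˡ i)

IsPartition : ∀ {m ℓ} → (Fin ℓ → Subset m) → Set
IsPartition {m} {ℓ} 𝒥 =
  (∀ k → Nonempty (𝒥 k))
  × (∀ (i : Fin m) → ∃ λ k → i ∈ 𝒥 k)
  × (∀ (i : Fin m) k k' → i ∈ 𝒥 k → i ∈ 𝒥 k' → k ≡ k')

IsInvariantPartition : ∀ {m q ℓ} → (Aut m q → Set) → (Fin ℓ → Subset m) → Set
IsInvariantPartition X 𝒥 =
  IsPartition 𝒥 × (∀ x k → X x → ∃ λ k' → 𝒥 k' ≡ image (σ x) (𝒥 k))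

size : ∀ {m} → Subset m → ℕ
size [] = 0
size (true ∷ J) = suc (size J)
size (false ∷ J) = size J

proj : ∀ {m} {A : Set} (J : Subset m) → Vec A m → Vec A (size J)
proj [] [] = []
proj (true ∷ J) (a ∷ v) = a ∷ proj J v
proj (false ∷ J) (a ∷ v) = proj J v

projCode : ∀ {m q} (J : Subset m) → Code m q → Vec (Fin q) (size J) → Set
projCode {m} {q} J C β = Σ (Word m q) λ α → C α × proj J α ≡ β

ext : ∀ {m} {A : Set} (J : Subset m) → A → Vec A (size J) → Vec A m
ext [] d [] = []
ext (true ∷ J) d (b ∷ bs) = b ∷ ext J d bs
ext (false ∷ J) d bs = d ∷ ext J d bs

headOr : ∀ {n} {A : Set} → Vec A n → (A → Vec A n) → Vec A n
headOr [] k = []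
headOr (a ∷ v) k = k a

Stab : ∀ {m q} → (Aut m q → Set) → Subset m → Aut m q → Set
Stab X J x = X x × image (σ x) J ≡ J

-- χ(x) : π_J(α) ↦ π_J(α^x), evaluated with the preimage α = ext J d β
-- (for x ∈ X_J the value does not depend on the chosen preimage).
χ : ∀ {m q} (J : Subset m) → Aut m q → Vec (Fin q) (size J) → Vec (Fin q) (size J)
χ J x β = headOr β λ d → proj J (act (ext J d β) x)

-- Elements of the permutation group χ(X_J)|π_J(C)
-- are represented by x ∈ X_J, two representatives being equal iff they
-- induce the same permutation of π_J(C).

SamePerm : ∀ {m q} (C : Code m q) (J : Subset m) → Aut m q → Aut m q → Set
SamePerm C J x y = ∀ β → projCode J C β → χ J x β ≡ χ J y β

PermIsoActions : ∀ {m q} → (Aut m q → Set) → Code m q → Subset m → Subset m → Set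
PermIsoActions {m} {q} X C J J' =
  Σ (Vec (Fin q) (size J) → Vec (Fin q) (size J')) λ lam →
    (∀ β → projCode J C β → projCode J' C (lam β))
  × (∀ β γ → projCode J C β → projCode J C γ → lam β ≡ lam γ → β ≡ γ)
  × (∀ γ → projCode J' C γ → Σ (Vec (Fin q) (size J)) λ β → projCode J C β × lam β ≡ γ)
  × Σ (Aut m q → Aut m q) λ φ →
      (∀ x → Stab X J x → Stab X J' (φ x))
    × (∀ x y → Stab X J x → Stab X J y → SamePerm C J x y → SamePerm C J' (φ x) (φ y))
    × (∀ x y z → Stab X J x → Stab X J y → Stab X J z →
         (∀ β → projCode J C β → χ J z β ≡ χ J y (χ J x β)) →
         ∀ γ → projCode J' C γ → χ J' (φ z) γ ≡ χ J' (φ y) (χ J' (φ x) γ))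
    × (∀ x y → Stab X J x → Stab X J y → SamePerm C J' (φ x) (φ y) → SamePerm C J x y)
    × (∀ y → Stab X J' y → Σ (Aut m q) λ x → Stab X J x × SamePerm C J' (φ x) y)
    × (∀ x β → Stab X J x → projCode J C β → lam (χ J x β) ≡ χ J' (φ x) (lam β))

-- Since the minimum distance is at least 3, every word at distance one from a
-- codeword α is adjacent to no other codeword.  Changing α in coordinate i
-- resp. j gives two elements of C₁; an x ∈ X mapping the first to the second
-- must fix α, and hence carry coordinate i to coordinate j.  So X is
-- transitive on M, and as 𝒥 is X-invariant some x ∈ X maps J onto J'.  Such
-- an x transports everything: β ↦ π_J'(α^x) for β = π_J(α) is a bijection
-- π_J(C) → π_J'(C) preserving distances, and it intertwines χ(y) with
-- χ(x⁻¹ y x).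
module Submission where

open import Defs
open import Data.Bool using (true; false; if_then_else_)
open import Data.Empty using (⊥-elim)
open import Data.Fin using (Fin; zero; suc; _≟_)
open import Data.Fin.Permutation using (Permutation′; _⟨$⟩ʳ_; _⟨$⟩ˡ_; _∘ₚ_; flip; inverseˡ; inverseʳ)
open import Data.Fin.Subset using (Subset; ⊤; _∈_)
open import Data.Nat using (ℕ; suc; _+_; _≤_; z≤n; s≤s)
open import Data.Nat.Properties
  using (≤-trans; +-mono-≤; 0≢1+n; module ≤-Reasoning; +-0-commutativeMonoid; +-commutativeSemigroup)
open import Algebra.Properties.CommutativeMonoid.Sum +-0-commutativeMonoid using (sum; sum-cong-≗; sum-permute)
open import Algebra.Properties.CommutativeSemigroup +-commutativeSemigroup using (interchange)
open import Data.Product using (Σ; _×_; _,_; proj₁; proj₂)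
open import Data.Vec using (Vec; []; _∷_; lookup; _[_]≔_)
open import Data.Vec.Properties
  using (lookup∘tabulate; tabulate∘lookup; tabulate-cong; ∷-injective; lookup∘update; lookup∘update′;
         lookup-replicate; ≡-dec; []=⇒lookup; lookup⇒[]=)
open import Relation.Binary.PropositionalEquality
open import Relation.Nullary using (¬_; yes; no)

perm-injective : ∀ {n} (π : Permutation′ n) {a b} → π ⟨$⟩ʳ a ≡ π ⟨$⟩ʳ b → a ≡ b
perm-injective π e = trans (sym (inverseˡ π)) (trans (cong (π ⟨$⟩ˡ_) e) (inverseˡ π))

lookup-ext : ∀ {n} {A : Set} (u v : Vec A n) → (∀ i → lookup u i ≡ lookup v i) → u ≡ v
lookup-ext u v p = trans (sym (tabulate∘lookup u)) (trans (tabulate-cong p) (tabulate∘lookup v))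

module _ {m q : ℕ} where

  lookup-act : ∀ (α : Word m q) x i → lookup (act α x) i ≡ h x (σ x ⟨$⟩ˡ i) ⟨$⟩ʳ lookup α (σ x ⟨$⟩ˡ i)
  lookup-act α x i = lookup∘tabulate _ i

  lookup-act-σ : ∀ (α : Word m q) x i → lookup (act α x) (σ x ⟨$⟩ʳ i) ≡ h x i ⟨$⟩ʳ lookup α i
  lookup-act-σ α x i = trans (lookup-act α x _) (cong (λ k → h x k ⟨$⟩ʳ lookup α k) (inverseˡ (σ x)))

  act-⊙ : ∀ (α : Word m q) x y → act (act α x) y ≡ act α (x ⊙ y)
  act-⊙ α x y = lookup-ext _ _ λ i → let k = σ x ⟨$⟩ˡ (σ y ⟨$⟩ˡ i) in begin
      lookup (act (act α x) y) i
    ≡⟨ lookup-act (act α x) y i ⟩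
      h y (σ y ⟨$⟩ˡ i) ⟨$⟩ʳ lookup (act α x) (σ y ⟨$⟩ˡ i)
    ≡⟨ cong (h y (σ y ⟨$⟩ˡ i) ⟨$⟩ʳ_) (lookup-act α x _) ⟩
      h y (σ y ⟨$⟩ˡ i) ⟨$⟩ʳ (h x k ⟨$⟩ʳ lookup α k)
    ≡⟨ cong (λ j → h y j ⟨$⟩ʳ (h x k ⟨$⟩ʳ lookup α k)) (sym (inverseʳ (σ x))) ⟩
      h y (σ x ⟨$⟩ʳ k) ⟨$⟩ʳ (h x k ⟨$⟩ʳ lookup α k)
    ≡⟨ sym (lookup-act α (x ⊙ y) i) ⟩
      lookup (act α (x ⊙ y)) i ∎
    where open ≡-Reasoning

  act-invAutʳ : ∀ (α : Word m q) x → act (act α x) (invAut x) ≡ α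
  act-invAutʳ α x = lookup-ext _ _ λ i → begin
      lookup (act (act α x) (invAut x)) i
    ≡⟨ lookup-act (act α x) (invAut x) i ⟩
      flip (h x _) ⟨$⟩ʳ lookup (act α x) (σ x ⟨$⟩ʳ i)
    ≡⟨ cong (flip (h x _) ⟨$⟩ʳ_) (lookup-act-σ α x i) ⟩
      flip (h x _) ⟨$⟩ʳ (h x i ⟨$⟩ʳ lookup α i)
    ≡⟨ cong (λ k → flip (h x k) ⟨$⟩ʳ (h x i ⟨$⟩ʳ lookup α i)) (inverseˡ (σ x)) ⟩
      flip (h x i) ⟨$⟩ʳ (h x i ⟨$⟩ʳ lookup α i)
    ≡⟨ inverseˡ (h x i) ⟩
      lookup α i ∎
    where open ≡-Reasoning

  act-invAutˡ : ∀ (α : Word m q) x → act (act α (invAut x)) x ≡ α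
  act-invAutˡ α x = lookup-ext _ _ λ i → let k = σ x ⟨$⟩ˡ i in begin
      lookup (act (act α (invAut x)) x) i
    ≡⟨ lookup-act (act α (invAut x)) x i ⟩
      h x k ⟨$⟩ʳ lookup (act α (invAut x)) k
    ≡⟨ cong (h x k ⟨$⟩ʳ_) (lookup-act α (invAut x) k) ⟩
      h x k ⟨$⟩ʳ (flip (h x (σ x ⟨$⟩ˡ (σ x ⟨$⟩ʳ k))) ⟨$⟩ʳ lookup α (σ x ⟨$⟩ʳ k))
    ≡⟨ cong₂ (λ j l → h x k ⟨$⟩ʳ (flip (h x j) ⟨$⟩ʳ lookup α l)) (inverseˡ (σ x)) (inverseʳ (σ x)) ⟩
      h x k ⟨$⟩ʳ (flip (h x k) ⟨$⟩ʳ lookup α i)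
    ≡⟨ inverseʳ (h x k) ⟩
      lookup α i ∎
    where open ≡-Reasoning

module _ {m : ℕ} where

  lookup-image : ∀ (s : Permutation′ m) J i → lookup (image s J) i ≡ lookup J (s ⟨$⟩ˡ i)
  lookup-image s J i = lookup∘tabulate _ i

  image-∘ₚ : ∀ (s t : Permutation′ m) J → image (s ∘ₚ t) J ≡ image t (image s J)
  image-∘ₚ s t J = lookup-ext _ _ λ i →
    trans (lookup-image (s ∘ₚ t) J i) (sym (trans (lookup-image t (image s J) i) (lookup-image s J (t ⟨$⟩ˡ i))))

  image-flip : ∀ (s : Permutation′ m) J J' → image s J ≡ J' → image (flip s) J' ≡ J
  image-flip s J J' e = lookup-ext _ _ λ i → begin
      lookup (image (flip s) J') i   ≡⟨ lookup-image (flip s) J' i ⟩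
      lookup J' (s ⟨$⟩ʳ i)           ≡⟨ cong (λ K → lookup K (s ⟨$⟩ʳ i)) (sym e) ⟩
      lookup (image s J) (s ⟨$⟩ʳ i)  ≡⟨ lookup-image s J _ ⟩
      lookup J (s ⟨$⟩ˡ (s ⟨$⟩ʳ i))   ≡⟨ cong (lookup J) (inverseˡ s) ⟩
      lookup J i                     ∎
    where open ≡-Reasoning

  image-⊤ : ∀ (s : Permutation′ m) → image s ⊤ ≡ ⊤
  image-⊤ s = lookup-ext _ _ λ i → trans (lookup-image s ⊤ i) (trans (lookup-replicate (s ⟨$⟩ˡ i) true) (sym (lookup-replicate i true)))

  lookup-image-σ : ∀ (s : Permutation′ m) J i → lookup (image s J) (s ⟨$⟩ʳ i) ≡ lookup J i
  lookup-image-σ s J i = trans (lookup-image s J _) (cong (lookup J) (inverseˡ s))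

  image-σ-⊙⊙ : ∀ {q} (a b c : Aut m q) K → image (σ ((a ⊙ b) ⊙ c)) K ≡ image (σ c) (image (σ b) (image (σ a) K))
  image-σ-⊙⊙ a b c K = trans (image-∘ₚ (σ a ∘ₚ σ b) (σ c) K) (cong (image (σ c)) (image-∘ₚ (σ a) (σ b) K))

module _ {A : Set} where

  proj-cong : ∀ {m} (J : Subset m) (α β : Vec A m) →
    (∀ i → lookup J i ≡ true → lookup α i ≡ lookup β i) → proj J α ≡ proj J β
  proj-cong []          []      []      p = refl
  proj-cong (true ∷ J)  (a ∷ α) (b ∷ β) p = cong₂ _∷_ (p zero refl) (proj-cong J α β (λ i → p (suc i)))
  proj-cong (false ∷ J) (a ∷ α) (b ∷ β) p = proj-cong J α β (λ i → p (suc i))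

  proj-≡⇒lookup-≡ : ∀ {m} (J : Subset m) (α β : Vec A m) →
    proj J α ≡ proj J β → ∀ i → lookup J i ≡ true → lookup α i ≡ lookup β i
  proj-≡⇒lookup-≡ (true ∷ J)  (a ∷ α) (b ∷ β) e zero    _ = proj₁ (∷-injective e)
  proj-≡⇒lookup-≡ (true ∷ J)  (a ∷ α) (b ∷ β) e (suc i) t = proj-≡⇒lookup-≡ J α β (proj₂ (∷-injective e)) i t
  proj-≡⇒lookup-≡ (false ∷ J) (a ∷ α) (b ∷ β) e (suc i) t = proj-≡⇒lookup-≡ J α β e i t

  proj-ext : ∀ {m} (J : Subset m) (d : A) β → proj J (ext J d β) ≡ β
  proj-ext []          d []      = refl
  proj-ext (true ∷ J)  d (b ∷ β) = cong (b ∷_) (proj-ext J d β)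
  proj-ext (false ∷ J) d β       = proj-ext J d β

module _ {m q : ℕ} where

  proj-act-cong : ∀ (x : Aut m q) J J' → image (σ x) J ≡ J' → (α β : Word m q) →
    proj J α ≡ proj J β → proj J' (act α x) ≡ proj J' (act β x)
  proj-act-cong x J J' e α β p = proj-cong J' _ _ λ i i∈J' →
    let σ⁻¹i∈J = trans (sym (lookup-image (σ x) J i)) (trans (cong (λ K → lookup K i) e) i∈J') in
    trans (lookup-act α x i)
      (trans (cong (h x _ ⟨$⟩ʳ_) (proj-≡⇒lookup-≡ J α β p _ σ⁻¹i∈J)) (sym (lookup-act β x i)))

  proj-act-cancel : ∀ (x : Aut m q) J J' → image (σ x) J ≡ J' → (α β : Word m q) →
    proj J' (act α x) ≡ proj J' (act β x) → proj J α ≡ proj J β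
  proj-act-cancel x J J' e α β p =
    subst₂ (λ u v → proj J u ≡ proj J v) (act-invAutʳ α x) (act-invAutʳ β x)
      (proj-act-cong (invAut x) J' J (image-flip (σ x) J J' e) (act α x) (act β x) p)

  -- χ J y evaluates at one particular preimage; for y ∈ X_J any preimage does.
  χ-proj : ∀ (y : Aut m q) J → image (σ y) J ≡ J → (α : Word m q) →
    χ J y (proj J α) ≡ proj J (act α y)
  χ-proj y J e α = headOr-const (proj J α) λ d →
      proj-act-cong y J J e (ext J d (proj J α)) α (proj-ext J d (proj J α))
    where
    headOr-const : ∀ {n} {B : Set} (β : Vec B n) {k : B → Vec B n} {v : Vec B n} →
      (∀ d → k d ≡ v) → headOr β k ≡ v
    headOr-const []      {v = []} p = refl
    headOr-const (a ∷ β) p          = p a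

mismatch : ∀ {q} → Fin q → Fin q → ℕ
mismatch a b with a ≟ b
... | yes _ = 0
... | no  _ = 1

mismatchOn : ∀ {m q} → Subset m → Word m q → Word m q → Fin m → ℕ
mismatchOn J α β i = if lookup J i then mismatch (lookup α i) (lookup β i) else 0

module _ {q : ℕ} where

  dist-∷ : ∀ {n} (a b : Fin q) (α β : Vec (Fin q) n) → dist (a ∷ α) (b ∷ β) ≡ mismatch a b + dist α β
  dist-∷ a b α β with a ≟ b
  ... | yes _ = refl
  ... | no  _ = refl

  mismatch-perm : ∀ (π : Permutation′ q) a b → mismatch (π ⟨$⟩ʳ a) (π ⟨$⟩ʳ b) ≡ mismatch a b
  mismatch-perm π a b with (π ⟨$⟩ʳ a) ≟ (π ⟨$⟩ʳ b) | a ≟ b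
  ... | yes _   | yes _  = refl
  ... | no  _   | no  _  = refl
  ... | yes πa≡πb | no a≢b = ⊥-elim (a≢b (perm-injective π πa≡πb))
  ... | no πa≢πb | yes a≡b = ⊥-elim (πa≢πb (cong (π ⟨$⟩ʳ_) a≡b))

  mismatch-triangle : ∀ (a b c : Fin q) → mismatch a c ≤ mismatch a b + mismatch b c
  mismatch-triangle a b c with a ≟ c
  ... | yes _ = z≤n
  ... | no a≢c with a ≟ b | b ≟ c
  ...   | no  _    | _        = s≤s z≤n
  ...   | yes _    | no  _    = s≤s z≤n
  ...   | yes refl | yes refl = ⊥-elim (a≢c refl)

  dist-refl : ∀ {n} (α : Vec (Fin q) n) → dist α α ≡ 0
  dist-refl []      = refl
  dist-refl (a ∷ α) with a ≟ a
  ... | yes _   = dist-refl α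
  ... | no  a≢a = ⊥-elim (a≢a refl)

  dist-sym : ∀ {n} (α β : Vec (Fin q) n) → dist α β ≡ dist β α
  dist-sym []      []      = refl
  dist-sym (a ∷ α) (b ∷ β) with a ≟ b | b ≟ a
  ... | yes _   | yes _   = dist-sym α β
  ... | no  _   | no  _   = cong suc (dist-sym α β)
  ... | yes a≡b | no  b≢a = ⊥-elim (b≢a (sym a≡b))
  ... | no  a≢b | yes b≡a = ⊥-elim (a≢b (sym b≡a))

  dist-triangle : ∀ {n} (α β γ : Vec (Fin q) n) → dist α γ ≤ dist α β + dist β γ
  dist-triangle []      []      []      = z≤n
  dist-triangle (a ∷ α) (b ∷ β) (c ∷ γ) = begin
      dist (a ∷ α) (c ∷ γ)                                     ≡⟨ dist-∷ a c α γ ⟩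
      mismatch a c + dist α γ                                  ≤⟨ +-mono-≤ (mismatch-triangle a b c) (dist-triangle α β γ) ⟩
      (mismatch a b + mismatch b c) + (dist α β + dist β γ)    ≡⟨ interchange (mismatch a b) _ _ _ ⟩
      (mismatch a b + dist α β) + (mismatch b c + dist β γ)    ≡⟨ sym (cong₂ _+_ (dist-∷ a b α β) (dist-∷ b c β γ)) ⟩
      dist (a ∷ α) (b ∷ β) + dist (b ∷ β) (c ∷ γ)              ∎
    where open ≤-Reasoning

  dist-update : ∀ {n} (α : Vec (Fin q) n) i b → b ≢ lookup α i → dist α (α [ i ]≔ b) ≡ 1
  dist-update (a ∷ α) zero    b b≢a = trans (dist-∷ a b α α) (cong₂ _+_ (mismatch-≢ b≢a) (dist-refl α))
    where
    mismatch-≢ : b ≢ a → mismatch a b ≡ 1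
    mismatch-≢ b≢a with a ≟ b
    ... | yes a≡b = ⊥-elim (b≢a (sym a≡b))
    ... | no  _   = refl
  dist-update (a ∷ α) (suc i) b b≢αᵢ = trans (dist-∷ a a α _) (cong₂ _+_ (mismatch-refl a) (dist-update α i b b≢αᵢ))
    where
    mismatch-refl : ∀ a → mismatch a a ≡ 0
    mismatch-refl a with a ≟ a
    ... | yes _   = refl
    ... | no  a≢a = ⊥-elim (a≢a refl)

-- Distances are sums of mismatches over coordinates, which reindexing by σ leaves unchanged.

dist≡sum : ∀ {m q} (α β : Word m q) → dist α β ≡ sum (mismatchOn ⊤ α β)
dist≡sum []      []      = refl
dist≡sum (a ∷ α) (b ∷ β) = trans (dist-∷ a b α β) (cong (mismatch a b +_) (dist≡sum α β))

dist-proj≡sum : ∀ {m q} (J : Subset m) (α β : Word m q) → dist (proj J α) (proj J β) ≡ sum (mismatchOn J α β)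
dist-proj≡sum []          []      []      = refl
dist-proj≡sum (true ∷ J)  (a ∷ α) (b ∷ β) = trans (dist-∷ a b _ _) (cong (mismatch a b +_) (dist-proj≡sum J α β))
dist-proj≡sum (false ∷ J) (a ∷ α) (b ∷ β) = dist-proj≡sum J α β

sum-mismatchOn-act : ∀ {m q} (x : Aut m q) J J' → image (σ x) J ≡ J' → (α β : Word m q) →
  sum (mismatchOn J' (act α x) (act β x)) ≡ sum (mismatchOn J α β)
sum-mismatchOn-act x J J' e α β =
  trans (sum-cong-≗ pointwise) (sym (sum-permute (mismatchOn J α β) (flip (σ x))))
  where
  pointwise : ∀ i → mismatchOn J' (act α x) (act β x) i ≡ mismatchOn J α β (σ x ⟨$⟩ˡ i)
  pointwise i rewrite lookup-act α x i | lookup-act β x i | sym e | lookup-image (σ x) J i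
    with lookup J (σ x ⟨$⟩ˡ i)
  ... | true  = mismatch-perm (h x (σ x ⟨$⟩ˡ i)) _ _
  ... | false = refl

dist-act : ∀ {m q} (x : Aut m q) (α β : Word m q) → dist (act α x) (act β x) ≡ dist α β
dist-act x α β = begin
    dist (act α x) (act β x)                ≡⟨ dist≡sum (act α x) (act β x) ⟩
    sum (mismatchOn ⊤ (act α x) (act β x))  ≡⟨ sum-mismatchOn-act x ⊤ ⊤ (image-⊤ (σ x)) α β ⟩
    sum (mismatchOn ⊤ α β)                  ≡⟨ sym (dist≡sum α β) ⟩
    dist α β                                ∎
  where open ≡-Reasoning

dist-proj-act : ∀ {m q} (x : Aut m q) J J' → image (σ x) J ≡ J' → (α β : Word m q) →
  dist (proj J' (act α x)) (proj J' (act β x)) ≡ dist (proj J α) (proj J β)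
dist-proj-act x J J' e α β = begin
    dist (proj J' (act α x)) (proj J' (act β x))  ≡⟨ dist-proj≡sum J' (act α x) (act β x) ⟩
    sum (mismatchOn J' (act α x) (act β x))       ≡⟨ sum-mismatchOn-act x J J' e α β ⟩
    sum (mismatchOn J α β)                        ≡⟨ sym (dist-proj≡sum J α β) ⟩
    dist (proj J α) (proj J β)                    ∎
  where open ≡-Reasoning

another-letter : ∀ {n q} {α β : Vec (Fin q) n} → α ≢ β → (c : Fin q) → Σ (Fin q) λ d → d ≢ c
another-letter {α = []}    {[]}    α≢β c = ⊥-elim (α≢β refl)
another-letter {α = a ∷ α} {b ∷ β} α≢β c with a ≟ b
... | yes refl = another-letter (λ e → α≢β (cong (a ∷_) e)) c
... | no a≢b with c ≟ a
...   | yes refl = b , λ b≡a → a≢b (sym b≡a)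
...   | no  c≢a  = a , λ a≡c → c≢a (sym a≡c)

module _ {m q δ : ℕ} {C : Code m q} (3≤δ : 3 ≤ δ)
  (δ≤dist : ∀ α β → C α → C β → α ≢ β → δ ≤ dist α β) where

  close-codewords-equal : ∀ {α β : Word m q} → C α → C β → dist α β ≤ 2 → α ≡ β
  close-codewords-equal {α} {β} Cα Cβ d≤2 with ≡-dec _≟_ α β
  ... | yes α≡β = α≡β
  ... | no  α≢β with ≤-trans 3≤δ (≤-trans (δ≤dist α β Cα Cβ α≢β) d≤2)
  ...   | s≤s (s≤s ())

  adjacent-to-codeword : ∀ {α ν : Word m q} → C α → dist α ν ≡ 1 → Nbhd C ν
  adjacent-to-codeword {α} {ν} Cα d≡1 = ν∉C , α , Cα , trans (dist-sym ν α) d≡1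
    where
    ν∉C : ¬ C ν
    ν∉C Cν with close-codewords-equal Cα Cν (subst (_≤ 2) (sym d≡1) (s≤s z≤n))
    ... | refl = 0≢1+n (trans (sym (dist-refl α)) d≡1)

coordinate-transitive : ∀ {m q} (X : Aut m q → Set) (C : Code m q) →
  NeighbourTransitive X C → (Σ ℕ λ δ → 3 ≤ δ × HasMinDist C δ) →
  (i j : Fin m) → Σ (Aut m q) λ x → X x × σ x ⟨$⟩ʳ i ≡ j
coordinate-transitive {m} {q} X C ((_ , X-closed , _) , (_ , _ , C₁-transitive))
    (δ , 3≤δ , (α , β , Cα , _ , α≢β , _) , δ≤dist) i j = x , Xx , σi≡j
  where
  b : Fin m → Fin q
  b k = proj₁ (another-letter α≢β (lookup α k))
  ν : Fin m → Word m q
  ν k = α [ k ]≔ b k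
  α-ν : ∀ k → dist α (ν k) ≡ 1
  α-ν k = dist-update α k (b k) (proj₂ (another-letter α≢β (lookup α k)))
  ν-differs : ∀ k → lookup (ν k) k ≢ lookup α k
  ν-differs k e = proj₂ (another-letter α≢β (lookup α k)) (trans (sym (lookup∘update k α (b k))) e)
  x-transports : Σ (Aut m q) λ x → X x × act (ν i) x ≡ ν j
  x-transports = C₁-transitive (ν i) (ν j) (adjacent-to-codeword 3≤δ δ≤dist Cα (α-ν i))
    (adjacent-to-codeword 3≤δ δ≤dist Cα (α-ν j))
  x : Aut m q
  x = proj₁ x-transports
  Xx : X x
  Xx = proj₁ (proj₂ x-transports)
  νᵢx≡νⱼ : act (ν i) x ≡ ν j
  νᵢx≡νⱼ = proj₂ (proj₂ x-transports)
  -- α and αˣ are codewords at distance ≤ 2 (via ν j = (ν i)ˣ), so x fixes α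
  αx≡α : act α x ≡ α
  αx≡α = close-codewords-equal 3≤δ δ≤dist (X-closed α x Cα Xx) Cα (begin
      dist (act α x) α                                ≤⟨ dist-triangle (act α x) (ν j) α ⟩
      dist (act α x) (ν j) + dist (ν j) α             ≡⟨ cong₂ _+_ (trans (cong (dist (act α x)) (sym νᵢx≡νⱼ)) (dist-act x α (ν i)))
                                                                 (dist-sym (ν j) α) ⟩
      dist α (ν i) + dist α (ν j)                     ≡⟨ cong₂ _+_ (α-ν i) (α-ν j) ⟩
      2                                               ∎)
    where open ≤-Reasoning
  νⱼ-differs-at-σi : lookup (ν j) (σ x ⟨$⟩ʳ i) ≢ lookup α (σ x ⟨$⟩ʳ i)
  νⱼ-differs-at-σi e = ν-differs i (perm-injective (h x i) (begin
      h x i ⟨$⟩ʳ lookup (ν i) i            ≡⟨ sym (lookup-act-σ (ν i) x i) ⟩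
      lookup (act (ν i) x) (σ x ⟨$⟩ʳ i)    ≡⟨ cong (λ v → lookup v (σ x ⟨$⟩ʳ i)) νᵢx≡νⱼ ⟩
      lookup (ν j) (σ x ⟨$⟩ʳ i)            ≡⟨ e ⟩
      lookup α (σ x ⟨$⟩ʳ i)                ≡⟨ cong (λ v → lookup v (σ x ⟨$⟩ʳ i)) (sym αx≡α) ⟩
      lookup (act α x) (σ x ⟨$⟩ʳ i)        ≡⟨ lookup-act-σ α x i ⟩
      h x i ⟨$⟩ʳ lookup α i                ∎))
    where open ≡-Reasoning
  σi≡j : σ x ⟨$⟩ʳ i ≡ j
  σi≡j with σ x ⟨$⟩ʳ i ≟ j
  ... | yes e   = e
  ... | no σi≢j = ⊥-elim (νⱼ-differs-at-σi (lookup∘update′ σi≢j α (b j)))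

module Transport {m q} (X : Aut m q → Set) (C : Code m q) (X-subgroup : IsSubgroup X)
  (X-closed : ∀ α x → C α → X x → C (act α x))
  (x : Aut m q) (Xx : X x) (J J' : Subset m) (J^x≡J' : image (σ x) J ≡ J') (d : Fin q) where

  private
    x⁻¹ : Aut m q
    x⁻¹ = invAut x
    X-mul : ∀ y z → X y → X z → X (y ⊙ z)
    X-mul = proj₁ (proj₂ X-subgroup)
    Xx⁻¹ : X x⁻¹
    Xx⁻¹ = proj₂ (proj₂ X-subgroup) x Xx
    J'^x⁻¹≡J : image (σ x⁻¹) J' ≡ J
    J'^x⁻¹≡J = image-flip (σ x) J J' J^x≡J'

  relabel : Vec (Fin q) (size J) → Vec (Fin q) (size J')
  relabel β = proj J' (act (ext J d β) x)

  relabel-proj : ∀ α → relabel (proj J α) ≡ proj J' (act α x)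
  relabel-proj α = proj-act-cong x J J' J^x≡J' (ext J d (proj J α)) α (proj-ext J d (proj J α))

  conj : Aut m q → Aut m q
  conj y = (x⁻¹ ⊙ y) ⊙ x

  act-conj : ∀ α y → act (act α x) (conj y) ≡ act (act α y) x
  act-conj α y = begin
      act (act α x) ((x⁻¹ ⊙ y) ⊙ x)       ≡⟨ sym (act-⊙ (act α x) (x⁻¹ ⊙ y) x) ⟩
      act (act (act α x) (x⁻¹ ⊙ y)) x     ≡⟨ cong (λ v → act v x) (sym (act-⊙ (act α x) x⁻¹ y)) ⟩
      act (act (act (act α x) x⁻¹) y) x   ≡⟨ cong (λ v → act (act v y) x) (act-invAutʳ α x) ⟩
      act (act α y) x                     ∎
    where open ≡-Reasoning

  conj-stab : ∀ y → Stab X J y → Stab X J' (conj y)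
  conj-stab y (Xy , J^y≡J) = X-mul _ _ (X-mul _ _ Xx⁻¹ Xy) Xx , (begin
      image (σ (conj y)) J'                          ≡⟨ image-σ-⊙⊙ x⁻¹ y x J' ⟩
      image (σ x) (image (σ y) (image (σ x⁻¹) J'))   ≡⟨ cong (λ K → image (σ x) (image (σ y) K)) J'^x⁻¹≡J ⟩
      image (σ x) (image (σ y) J)                    ≡⟨ cong (image (σ x)) J^y≡J ⟩
      image (σ x) J                                  ≡⟨ J^x≡J' ⟩
      J'                                             ∎)
    where open ≡-Reasoning

  χ-conj-proj : ∀ y → Stab X J y → ∀ α → χ J' (conj y) (proj J' (act α x)) ≡ proj J' (act (act α y) x)
  χ-conj-proj y Sy α = trans (χ-proj (conj y) J' (proj₂ (conj-stab y Sy)) (act α x)) (cong (proj J') (act-conj α y))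

  preimage : ∀ γ → projCode J' C γ → Σ (Word m q) λ α → C α × proj J' (act α x) ≡ γ
  preimage γ (α' , Cα' , p) = act α' x⁻¹ , X-closed α' x⁻¹ Cα' Xx⁻¹ , trans (cong (proj J') (act-invAutˡ α' x)) p

  projCode′-elim : (P : Vec (Fin q) (size J') → Set) → (∀ α → C α → P (proj J' (act α x))) →
    ∀ γ → projCode J' C γ → P γ
  projCode′-elim P f γ γ∈ with preimage γ γ∈
  ... | α , Cα , refl = f α Cα

  relabel-maps-to : ∀ β → projCode J C β → projCode J' C (relabel β)
  relabel-maps-to β (α , Cα , refl) = act α x , X-closed α x Cα Xx , sym (relabel-proj α)

  relabel-injective : ∀ β γ → projCode J C β → projCode J C γ → relabel β ≡ relabel γ → β ≡ γ
  relabel-injective β γ (α , _ , refl) (α' , _ , refl) e =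
    proj-act-cancel x J J' J^x≡J' α α' (trans (sym (relabel-proj α)) (trans e (relabel-proj α')))

  relabel-surjective : ∀ γ → projCode J' C γ → Σ (Vec (Fin q) (size J)) λ β → projCode J C β × relabel β ≡ γ
  relabel-surjective γ γ∈ with preimage γ γ∈
  ... | α , Cα , p = proj J α , (α , Cα , refl) , trans (relabel-proj α) p

  relabel-dist : ∀ α α' → dist (relabel (proj J α)) (relabel (proj J α')) ≡ dist (proj J α) (proj J α')
  relabel-dist α α' = trans (cong₂ dist (relabel-proj α) (relabel-proj α')) (dist-proj-act x J J' J^x≡J' α α')

  relabel-χ : ∀ y β → Stab X J y → projCode J C β → relabel (χ J y β) ≡ χ J' (conj y) (relabel β)
  relabel-χ y β Sy (α , Cα , refl) = begin
      relabel (χ J y (proj J α))              ≡⟨ cong relabel (χ-proj y J (proj₂ Sy) α) ⟩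
      relabel (proj J (act α y))              ≡⟨ relabel-proj (act α y) ⟩
      proj J' (act (act α y) x)               ≡⟨ sym (χ-conj-proj y Sy α) ⟩
      χ J' (conj y) (proj J' (act α x))       ≡⟨ cong (χ J' (conj y)) (sym (relabel-proj α)) ⟩
      χ J' (conj y) (relabel (proj J α))      ∎
    where open ≡-Reasoning

  χ-via-relabel : ∀ y α → Stab X J y → C α → χ J' (conj y) (proj J' (act α x)) ≡ relabel (χ J y (proj J α))
  χ-via-relabel y α Sy Cα =
    trans (cong (χ J' (conj y)) (sym (relabel-proj α))) (sym (relabel-χ y (proj J α) Sy (α , Cα , refl)))

  conj-respects : ∀ y z → Stab X J y → Stab X J z → SamePerm C J y z → SamePerm C J' (conj y) (conj z)
  conj-respects y z Sy Sz y≈z = projCode′-elim _ λ α Cα →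
    trans (χ-via-relabel y α Sy Cα)
      (trans (cong relabel (y≈z (proj J α) (α , Cα , refl))) (sym (χ-via-relabel z α Sz Cα)))

  conj-mul : ∀ y z w → Stab X J y → Stab X J z → Stab X J w →
    (∀ β → projCode J C β → χ J w β ≡ χ J z (χ J y β)) →
    ∀ γ → projCode J' C γ → χ J' (conj w) γ ≡ χ J' (conj z) (χ J' (conj y) γ)
  conj-mul y z w Sy Sz Sw w≈yz = projCode′-elim _ λ α Cα → begin
      χ J' (conj w) (proj J' (act α x))                                  ≡⟨ χ-via-relabel w α Sw Cα ⟩
      relabel (χ J w (proj J α))                                         ≡⟨ cong relabel (w≈yz (proj J α) (α , Cα , refl)) ⟩
      relabel (χ J z (χ J y (proj J α)))                                 ≡⟨ cong (λ β → relabel (χ J z β)) (χ-proj y J (proj₂ Sy) α) ⟩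
      relabel (χ J z (proj J (act α y)))                                 ≡⟨ sym (χ-via-relabel z (act α y) Sz (X-closed α y Cα (proj₁ Sy))) ⟩
      χ J' (conj z) (proj J' (act (act α y) x))                          ≡⟨ cong (χ J' (conj z)) (sym (χ-conj-proj y Sy α)) ⟩
      χ J' (conj z) (χ J' (conj y) (proj J' (act α x)))                  ∎
    where open ≡-Reasoning

  conj-reflects : ∀ y z → Stab X J y → Stab X J z → SamePerm C J' (conj y) (conj z) → SamePerm C J y z
  conj-reflects y z Sy Sz cy≈cz β (α , Cα , refl) =
    relabel-injective _ _ (χ-maps-to y Sy) (χ-maps-to z Sz)
      (trans (sym (χ-via-relabel y α Sy Cα))
        (trans (cy≈cz _ (act α x , X-closed α x Cα Xx , refl)) (χ-via-relabel z α Sz Cα)))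
    where
    χ-maps-to : ∀ y → Stab X J y → projCode J C (χ J y (proj J α))
    χ-maps-to y Sy = act α y , X-closed α y Cα (proj₁ Sy) , sym (χ-proj y J (proj₂ Sy) α)

  conj-onto : ∀ y → Stab X J' y → Σ (Aut m q) λ w → Stab X J w × SamePerm C J' (conj w) y
  conj-onto y (Xy , J'^y≡J') = w , Sw , projCode′-elim _ λ α Cα → begin
      χ J' (conj w) (proj J' (act α x))   ≡⟨ χ-conj-proj w Sw α ⟩
      proj J' (act (act α w) x)           ≡⟨ cong (proj J') (act-w-x α) ⟩
      proj J' (act (act α x) y)           ≡⟨ sym (χ-proj y J' J'^y≡J' (act α x)) ⟩
      χ J' y (proj J' (act α x))          ∎
    where
    open ≡-Reasoning
    w = (x ⊙ y) ⊙ x⁻¹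
    Sw : Stab X J w
    Sw = X-mul _ _ (X-mul _ _ Xx Xy) Xx⁻¹ , (begin
        image (σ w) J                                  ≡⟨ image-σ-⊙⊙ x y x⁻¹ J ⟩
        image (σ x⁻¹) (image (σ y) (image (σ x) J))    ≡⟨ cong (λ K → image (σ x⁻¹) (image (σ y) K)) J^x≡J' ⟩
        image (σ x⁻¹) (image (σ y) J')                 ≡⟨ cong (image (σ x⁻¹)) J'^y≡J' ⟩
        image (σ x⁻¹) J'                               ≡⟨ J'^x⁻¹≡J ⟩
        J                                              ∎)
    act-w-x : ∀ α → act (act α w) x ≡ act (act α x) y
    act-w-x α = begin
        act (act α ((x ⊙ y) ⊙ x⁻¹)) x     ≡⟨ cong (λ v → act v x) (sym (act-⊙ α (x ⊙ y) x⁻¹)) ⟩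
        act (act (act α (x ⊙ y)) x⁻¹) x   ≡⟨ act-invAutˡ (act α (x ⊙ y)) x ⟩
        act α (x ⊙ y)                     ≡⟨ sym (act-⊙ α x y) ⟩
        act (act α x) y                   ∎

  perm-iso : PermIsoActions X C J J'
  perm-iso = relabel , relabel-maps-to , relabel-injective , relabel-surjective ,
             conj , conj-stab , conj-respects , conj-mul , conj-reflects , conj-onto , relabel-χ

  minDist-transport : ∀ δ → HasMinDist (projCode J C) δ → HasMinDist (projCode J' C) δ
  minDist-transport δ ((β , β' , β∈@(α , Cα , refl) , β'∈@(α' , Cα' , refl) , β≢β' , dist≡δ) , δ≤) =
    (relabel β , relabel β' , relabel-maps-to β β∈ , relabel-maps-to β' β'∈ ,
      (λ e → β≢β' (relabel-injective β β' β∈ β'∈ e)) , trans (relabel-dist α α') dist≡δ) ,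
    λ γ γ' γ∈ γ'∈ γ≢γ' → δ≤′ (preimage γ γ∈) (preimage γ' γ'∈) γ≢γ'
    where
    δ≤′ : ∀ {γ γ'} → (Σ (Word m q) λ α → C α × proj J' (act α x) ≡ γ) →
      (Σ (Word m q) λ α → C α × proj J' (act α x) ≡ γ') → γ ≢ γ' → δ ≤ dist γ γ'
    δ≤′ (a , Ca , refl) (a' , Ca' , refl) γ≢γ' =
      subst (δ ≤_) (sym (dist-proj-act x J J' J^x≡J' a a'))
        (δ≤ (proj J a) (proj J a') (a , Ca , refl) (a' , Ca' , refl)
          (λ e → γ≢γ' (proj-act-cong x J J' J^x≡J' a a' e)))

image-block : ∀ {m q ℓ} {X : Aut m q → Set} {𝒥 : Fin ℓ → Subset m} → IsInvariantPartition X 𝒥 →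
  ∀ {x i k k'} → X x → i ∈ 𝒥 k → σ x ⟨$⟩ʳ i ∈ 𝒥 k' → image (σ x) (𝒥 k) ≡ 𝒥 k'
image-block {𝒥 = 𝒥} ((_ , _ , unique) , invariant) {x} {i} {k} {k'} Xx i∈ σi∈ with invariant x k Xx
... | k″ , 𝒥k″≡J^x = trans (sym 𝒥k″≡J^x) (cong 𝒥 (unique (σ x ⟨$⟩ʳ i) k″ k' σi∈𝒥k″ σi∈))
  where
  σi∈𝒥k″ : σ x ⟨$⟩ʳ i ∈ 𝒥 k″
  σi∈𝒥k″ = lookup⇒[]= _ (𝒥 k″)
    (trans (cong (λ K → lookup K (σ x ⟨$⟩ʳ i)) 𝒥k″≡J^x) (trans (lookup-image-σ (σ x) (𝒥 k) i) ([]=⇒lookup i∈)))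

lemma3p6 : ∀ {m q ℓ} (X : Aut m q → Set) (C : Code m q) (𝒥 : Fin ℓ → Subset m) →
    IsSubgroup X →
    NeighbourTransitive X C →
    (Σ ℕ λ δ → 3 ≤ δ × HasMinDist C δ) →
    IsInvariantPartition X 𝒥 →
    (k k' : Fin ℓ) →
    PermIsoActions X C (𝒥 k) (𝒥 k')
    × (∀ d → (HasMinDist (projCode (𝒥 k) C) d → HasMinDist (projCode (𝒥 k') C) d)
    × (HasMinDist (projCode (𝒥 k') C) d → HasMinDist (projCode (𝒥 k) C) d))
lemma3p6 X C 𝒥 X-subgroup C-nt minDist 𝒥-invariant k k'
  with proj₁ (proj₁ 𝒥-invariant) k | proj₁ (proj₁ 𝒥-invariant) k'
... | i , i∈ | j , j∈ with coordinate-transitive X C C-nt minDist i j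
...   | x , Xx , refl =
  Forward.perm-iso , λ δ → Forward.minDist-transport δ , Backward.minDist-transport δ
  where
  X-closed : ∀ α y → C α → X y → C (act α y)
  X-closed = proj₁ (proj₂ (proj₁ C-nt))
  J^x≡J' : image (σ x) (𝒥 k) ≡ 𝒥 k'
  J^x≡J' = image-block 𝒥-invariant Xx i∈ j∈
  -- any letter will do: it only pads the coordinates outside the block
  letter : Fin _
  letter = lookup (proj₁ (proj₁ (proj₁ C-nt))) i
  module Forward = Transport X C X-subgroup X-closed x Xx (𝒥 k) (𝒥 k') J^x≡J' letter
  module Backward = Transport X C X-subgroup X-closed (invAut x) (proj₂ (proj₂ X-subgroup) x Xx)
    (𝒥 k') (𝒥 k) (image-flip (σ x) (𝒥 k) (𝒥 k') J^x≡J') letter
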